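{- Let $P$ and $Q$ be Interface Automata with common input alphabet $I$ and common output alphabet $O$, and let $p\in P$, $q\in Q$. Then $p\sqsubseteq_{\mathrm{IA}} q$ if and only if $[\![p]\!]\sqsubseteq_{\mathrm{MIA}}[\![q]\!]$.
   Context: An Interface Automaton (IA) is $P=(P,I,O,\rightarrow_P)$ with states $P$, disjoint action sets $I,O$ not containing $\tau$, and $\rightarrow_P\subseteq P\times(I\cup O\cup\{\tau\})\times P$ input-deterministic (for $a\in I$, $p\xrightarrow{a}p'$ and $p\xrightarrow{a}p''$ imply $p'=p''$). IA weak transitions: $p\stackrel{\epsilon}{\Rightarrow}p'$ iff $p(\xrightarrow{\tau})^*p'$; for $o\in O$, $p\stackrel{o}{\Rightarrow}p'$ iff $\exists p''.\,p\stackrel{\epsilon}{\Rightarrow}p''\xrightarrow{o}p'$; $\hat\tau=\epsilon$, $\hat a=a$. $p\sqsubseteq_{\mathrm{IA}}q$ iff some $\mathcal R\subseteq P\times Q$ containing $(p,q)$ satisfies for all $(p,q)\in\mathcal R$: (i) $q\xrightarrow{a}q'$, $a\in I$, implies $p\xrightarrow{a}p'$ with $(p',q')\in\mathcal R$; (ii) $p\xrightarrow{\alpha}p'$, $\alpha\in O\cup\{\tau\}$, implies $q\stackrel{\hat\alpha}{\Rightarrow}q'$ with $(p',q')\in\mathcal R$. A Modal Interface Automaton (MIA) is $(P,I,O,\longrightarrow_P,\dashrightarrow_P)$ with $I,O$ disjoint, must-relation $\longrightarrow_P\subseteq P\times(I\cup O)\times(2^P\setminus\{\emptyset\})$, may-relation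 $\dashrightarrow_P\subseteq P\times(I\cup O\cup\{\tau\})\times P$, syntactic consistency ($p\xrightarrow{a}P'$ implies $p\stackrel{a}{\dashrightarrow}p'$ for all $p'\in P'$), and for all $i\in I$: (a) $p\xrightarrow{i}P'$, $p\xrightarrow{i}P''$ imply $P'=P''$; (b) $p\stackrel{i}{\dashrightarrow}p'$ implies $p\xrightarrow{i}P'$ for some $P'\ni p'$. $p\xrightarrow{a}p'$ abbreviates $p\xrightarrow{a}\{p'\}$. Weak may: $p\stackrel{\epsilon}{\Longrightarrow}p'$ iff $p(\stackrel{\tau}{\dashrightarrow})^*p'$; $p\stackrel{\alpha}{\Longrightarrow}p'$ iff $\exists p''.\,p\stackrel{\epsilon}{\Longrightarrow}p''\stackrel{\alpha}{\dashrightarrow}p'$. $p\sqsubseteq_{\mathrm{MIA}}q$ iff some $\mathcal R\subseteq P\times Q$ containing $(p,q)$ satisfies for all $(p,q)\in\mathcal R$: (i) $q\xrightarrow{a}Q'$ ($a\in I\cup O$) implies some $p\xrightarrow{a}P'$ with $\forall p'\in P'\,\exists q'\in Q'.\,(p',q')\in\mathcal R$; (ii) $p\stackrel{\alpha}{\dashrightarrow}p'$, $\alpha\in O\cup\{\tau\}$, implies some $q\stackrel{\hat\alpha}{\Longrightarrow}q'$ with $(p',q')\in\mathcal R$. Embedding: for an IA $P$, $[\![P]\!]$ is the MIA $(P,I,O,\longrightarrow,\dashrightarrow)$ with $p\xrightarrow{i}p'$ (must) iff $p\xrightarrow{i}_Pp'$ and $i\in I$, and $p\stackrel{\alpha}{\dashrightarrow}p'$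 iff $p\xrightarrow{\alpha}_Pp'$ for $\alpha\in I\cup O\cup\{\tau\}$; $[\![p]\!]$ denotes $p$ as a state of $[\![P]\!]$. -}

module Defs where

open import Data.Product using (Σ; ∃; ∃-syntax; _×_; _,_)
open import Data.Sum using (_⊎_; inj₁; inj₂)
open import Relation.Binary.PropositionalEquality using (_≡_)
open import Relation.Binary.Construct.Closure.ReflexiveTransitive using (Star)
open import Data.Empty using (⊥)

data Label (I O : Set) : Set where
  inp : I → Label I O
  out : O → Label I O
  τ   : Label I O

Vis : Set → Set → Set
Vis I O = I ⊎ O

vis : {I O : Set} → Vis I O → Label I O
vis (inj₁ i) = inp i
vis (inj₂ o) = out o

record IA (I O : Set) : Set₁ where
  field
    St    : Set
    _⟶[_]_ : St → Label I O → St → Set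
    inputDet : ∀ {p p' p''} (i : I) → p ⟶[ inp i ] p' → p ⟶[ inp i ] p'' → p' ≡ p''
open IA public

-- IA weak transitions (only τ and outputs are needed)
τ-step : {I O : Set} (P : IA I O) → St P → St P → Set
τ-step P p p' = _⟶[_]_ P p τ p'

_⊢_⇒ε_ : {I O : Set} (P : IA I O) → St P → St P → Set
P ⊢ p ⇒ε p' = Star (τ-step P) p p'

data OutTau (O : Set) : Set where
  o! : O → OutTau O
  τ! : OutTau O

otLabel : {I O : Set} → OutTau O → Label I O
otLabel (o! o) = out o
otLabel τ!     = τ

IAweakHat : {I O : Set} (P : IA I O) → St P → OutTau O → St P → Set
IAweakHat P p τ!     p' = P ⊢ p ⇒ε p'
IAweakHat P p (o! o) p' = ∃[ p'' ] (P ⊢ p ⇒ε p'' × _⟶[_]_ P p'' (out o) p')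

record IA-Sim {I O : Set} (P Q : IA I O) (R : St P → St Q → Set) : Set where
  field
    inputs  : ∀ {p q q'} → R p q → (i : I) → _⟶[_]_ Q q (inp i) q' →
              ∃[ p' ] (_⟶[_]_ P p (inp i) p' × R p' q')
    outputs : ∀ {p q p'} → R p q → (α : OutTau O) → _⟶[_]_ P p (otLabel α) p' →
              ∃[ q' ] (IAweakHat Q q α q' × R p' q')

RefIA : {I O : Set} (P Q : IA I O) → St P → St Q → Set₁
RefIA P Q p q = ∃[ R ] (IA-Sim P Q R × R p q)

record MIA (I O : Set) : Set₁ where
  field
    St   : Set
    must : St → Vis I O → (St → Set) → Set
    may  : St → Label I O → St → Set
    must-nonempty : ∀ {p a P'} → must p a P' → ∃[ p' ] P' p'
    consistency : ∀ {p a P' p'} → must p a P' → P' p' → may p (vis a) p'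
    inputDet : ∀ {p P' P''} (i : I) → must p (inj₁ i) P' → must p (inj₁ i) P'' →
               ∀ x → (P' x → P'' x) × (P'' x → P' x)
    inputMust : ∀ {p p'} (i : I) → may p (inp i) p' → ∃[ P' ] (must p (inj₁ i) P' × P' p')

MIAweakHat : {I O : Set} (P : MIA I O) → MIA.St P → OutTau O → MIA.St P → Set
MIAweakHat P p τ!     p' = Star (λ x y → MIA.may P x τ y) p p'
MIAweakHat P p (o! o) p' =
  ∃[ p'' ] (Star (λ x y → MIA.may P x τ y) p p'' × MIA.may P p'' (out o) p')

record MIA-Sim {I O : Set} (P Q : MIA I O) (R : MIA.St P → MIA.St Q → Set) : Set₁ where
  field
    musts : ∀ {p q Q'} → R p q → (a : Vis I O) → MIA.must Q q a Q' →
            ∃[ P' ] (MIA.must P p a P' × (∀ p' → P' p' → ∃[ q' ] (Q' q' × R p' q')))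
    mays  : ∀ {p q p'} → R p q → (α : OutTau O) → MIA.may P p (otLabel α) p' →
            ∃[ q' ] (MIAweakHat Q q α q' × R p' q')

RefMIA : {I O : Set} (P Q : MIA I O) → MIA.St P → MIA.St Q → Set₁
RefMIA P Q p q = ∃[ R ] (MIA-Sim P Q R × R p q)

data EmbMust {I O : Set} (P : IA I O) (p : St P) : Vis I O → (St P → Set) → Set where
  emb-in : ∀ {i p'} → _⟶[_]_ P p (inp i) p' → EmbMust P p (inj₁ i) (λ x → x ≡ p')

open import Relation.Binary.PropositionalEquality using (refl; subst; sym)

⟦_⟧ : {I O : Set} → IA I O → MIA I O
⟦ P ⟧ = record
  { St = St P
  ; must = EmbMust P
  ; may = _⟶[_]_ P
  ; must-nonempty = λ { (emb-in {p' = p'} t) → p' , refl }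
  ; consistency = λ { (emb-in t) refl → t }
  ; inputDet = λ { i (emb-in t) (emb-in t') x →
       (λ e → Relation.Binary.PropositionalEquality.trans e (inputDet P i t t')) ,
       (λ e → Relation.Binary.PropositionalEquality.trans e (sym (inputDet P i t t'))) }
  ; inputMust = λ i t → _ , emb-in t , refl
  }

module Submission where

open import Defs
open import Data.Product using (_×_; _,_)
open import Data.Sum using (inj₁)
open import Function using (id)
open import Relation.Binary.PropositionalEquality using (_≡_; refl; subst; sym)

-- The embedding keeps every transition as a may-transition, so weak transitions agree,
-- and its must-transitions have singleton targets {p'}; hence the two simulation
-- conditions are the same conditions on the same relation R.

weak-⟦⟧ : {I O : Set} (Q : IA I O) (α : OutTau O) {q q' : St Q} →
          IAweakHat Q q α q' ≡ MIAweakHat ⟦ Q ⟧ q α q'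
weak-⟦⟧ Q τ!     = refl
weak-⟦⟧ Q (o! o) = refl

module _ {I O : Set} {P Q : IA I O} {R : St P → St Q → Set} where

  IA-Sim⇒MIA-Sim : IA-Sim P Q R → MIA-Sim ⟦ P ⟧ ⟦ Q ⟧ R
  MIA-Sim.musts (IA-Sim⇒MIA-Sim S) r (inj₁ i) (emb-in t) with IA-Sim.inputs S r i t
  ... | p' , t' , r' = (λ x → x ≡ p') , emb-in t' , λ { _ refl → _ , refl , r' }
  MIA-Sim.mays (IA-Sim⇒MIA-Sim S) r α t with IA-Sim.outputs S r α t
  ... | q' , w , r' = q' , subst id (weak-⟦⟧ Q α) w , r'

  MIA-Sim⇒IA-Sim : MIA-Sim ⟦ P ⟧ ⟦ Q ⟧ R → IA-Sim P Q R
  IA-Sim.inputs (MIA-Sim⇒IA-Sim S) r i t with MIA-Sim.musts S r (inj₁ i) (emb-in t)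
  ... | _ , emb-in t' , targets with targets _ refl
  ... | _ , refl , r' = _ , t' , r'
  IA-Sim.outputs (MIA-Sim⇒IA-Sim S) r α t with MIA-Sim.mays S r α t
  ... | q' , w , r' = q' , subst id (sym (weak-⟦⟧ Q α)) w , r'

theorem4p16 : {I O : Set} (P Q : IA I O) (p : St P) (q : St Q) →
              (RefIA P Q p q → RefMIA ⟦ P ⟧ ⟦ Q ⟧ p q) ×
              (RefMIA ⟦ P ⟧ ⟦ Q ⟧ p q → RefIA P Q p q)
theorem4p16 P Q p q =
  (λ { (R , S , r) → R , IA-Sim⇒MIA-Sim S , r }) ,
  (λ { (R , S , r) → R , MIA-Sim⇒IA-Sim S , r })
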